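{- In the system $\mathcal{D}$, if the sequent $\Gamma, C\Rightarrow D\vdash G$ has a proof, then the sequent $\Gamma, D\vdash G$ has a proof.
   Context: Propositions are first-order formulas built from atomic propositions $P(t_1,\dots,t_k)$ (predicate symbol applied to terms; $\top,\bot$ are not atomic), $\top$, $\bot$, $\wedge$, $\vee$, $\Rightarrow$, $\forall$, $\exists$. Sequents are $\Gamma\vdash G$ with $\Gamma$ a finite multiset of propositions and $G$ a proposition. The system $\mathcal{D}$ has the rules: axiom $\Gamma,P\vdash P$ ($P$ atomic); $\top$-right $\Gamma\vdash\top$; $\bot$-left $\Gamma,\bot\vdash G$; $\wedge$-left (from $\Gamma,A,B\vdash G$ infer $\Gamma,A\wedge B\vdash G$); $\wedge$-right (from $\Gamma\vdash A$, $\Gamma\vdash B$ infer $\Gamma\vdash A\wedge B$); $\vee$-left (from $\Gamma,A\vdash G$, $\Gamma,B\vdash G$ infer $\Gamma,A\vee B\vdash G$); $\vee$-right (from $\Gamma\vdash A$, or from $\Gamma\vdash B$, infer $\Gamma\vdash A\vee B$); $\Rightarrow$-left$_{axiom}$ (from $\Gamma,P,B\vdash G$ infer $\Gamma,P,P\Rightarrow B\vdash G$, $P$ atomic); $\Rightarrow$-left$_\top$ (from $\Gamma,B\vdash G$ infer $\Gamma,\top\Rightarrow B\vdash G$); $\Rightarrow$-left$_\wedge$ (from $\Gamma,C\Rightarrow B\vdash C$, $\Gamma,D\Rightarrow B\vdash D$, $\Gamma,B\vdash G$ infer $\Gamma,(C\wedge D)\Rightarrow B\vdash G$); two $\Rightarrow$-left$_\vee$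 rules (from $\Gamma,C\Rightarrow B,D\Rightarrow B\vdash C$ and $\Gamma,B\vdash G$, resp. from $\Gamma,C\Rightarrow B,D\Rightarrow B\vdash D$ and $\Gamma,B\vdash G$, infer $\Gamma,(C\vee D)\Rightarrow B\vdash G$); $\Rightarrow$-left$_\Rightarrow$ (from $\Gamma,D\Rightarrow B,C\vdash D$ and $\Gamma,B\vdash G$ infer $\Gamma,(C\Rightarrow D)\Rightarrow B\vdash G$); $\Rightarrow$-left$_\forall$ (from $\Gamma,(\forall x\,C)\Rightarrow B\vdash C$ and $\Gamma,B\vdash G$ infer $\Gamma,(\forall x\,C)\Rightarrow B\vdash G$, $x$ not free in $\Gamma,B$); $\Rightarrow$-left$_\exists$ (from $\Gamma,(\exists x\,C)\Rightarrow B\vdash(t/x)C$ and $\Gamma,B\vdash G$ infer $\Gamma,(\exists x\,C)\Rightarrow B\vdash G$); $\Rightarrow$-right (from $\Gamma,A\vdash B$ infer $\Gamma\vdash A\Rightarrow B$); $\forall$-right (from $\Gamma\vdash A$ infer $\Gamma\vdash\forall x\,A$, $x$ not free in $\Gamma$); contr-$\forall$-left (from $\Gamma,\forall x\,A,(t/x)A\vdash G$ infer $\Gamma,\forall x\,A\vdash G$); $\exists$-left (from $\Gamma,A\vdash G$ infer $\Gamma,\exists x\,A\vdash G$, $x$ not free in $\Gamma,G$); $\exists$-right (from $\Gamma\vdash(t/x)A$ infer $\Gamma\vdash\exists x\,A$). Here $t$ ranges over arbitrary terms. -}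

module Defs where

open import Data.Nat using (ℕ; zero; suc; _<?_; _≟_; pred)
open import Data.List using (List; []; _∷_; map)
open import Data.List.Relation.Binary.Permutation.Propositional using (_↭_)
open import Relation.Nullary using (yes; no)

-- First-order terms over an arbitrary signature, de Bruijn-indexed variables.
-- Function symbols and predicate symbols are named by natural numbers and
-- applied to a list of arguments (covers any first-order language).
data Term : Set where
  var : ℕ → Term
  fun : ℕ → List Term → Term

infixr 9 _∧'_
infixr 8 _∨'_
infixr 7 _⇒_

data Form : Set where
  atom  : ℕ → List Term → Form
  ⊤'    : Form
  ⊥'    : Form
  _∧'_  : Form → Form → Form
  _∨'_  : Form → Form → Form
  _⇒_   : Form → Form → Form
  ∀'    : Form → Form              -- binds de Bruijn index 0
  ∃'    : Form → Form

mutual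
  liftT : ℕ → Term → Term
  liftT c (var n) with n <? c
  ... | yes _ = var n
  ... | no  _ = var (suc n)
  liftT c (fun f ts) = fun f (liftTs c ts)

  liftTs : ℕ → List Term → List Term
  liftTs c [] = []
  liftTs c (t ∷ ts) = liftT c t ∷ liftTs c ts

liftF : ℕ → Form → Form
liftF c (atom p ts) = atom p (liftTs c ts)
liftF c ⊤' = ⊤'
liftF c ⊥' = ⊥'
liftF c (A ∧' B) = liftF c A ∧' liftF c B
liftF c (A ∨' B) = liftF c A ∨' liftF c B
liftF c (A ⇒ B) = liftF c A ⇒ liftF c B
liftF c (∀' A) = ∀' (liftF (suc c) A)
liftF c (∃' A) = ∃' (liftF (suc c) A)

↑ : Form → Form
↑ = liftF 0

↑ctx : List Form → List Form
↑ctx = map ↑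

mutual
  substT : ℕ → Term → Term → Term
  substT k u (var n) with n <? k
  ... | yes _ = var n
  ... | no  _ with n ≟ k
  ...   | yes _ = u
  ...   | no  _ = var (pred n)
  substT k u (fun f ts) = fun f (substTs k u ts)

  substTs : ℕ → Term → List Term → List Term
  substTs k u [] = []
  substTs k u (t ∷ ts) = substT k u t ∷ substTs k u ts

substF : ℕ → Term → Form → Form
substF k u (atom p ts) = atom p (substTs k u ts)
substF k u ⊤' = ⊤'
substF k u ⊥' = ⊥'
substF k u (A ∧' B) = substF k u A ∧' substF k u B
substF k u (A ∨' B) = substF k u A ∨' substF k u B
substF k u (A ⇒ B) = substF k u A ⇒ substF k u B
substF k u (∀' A) = ∀' (substF (suc k) (liftT 0 u) A)
substF k u (∃' A) = ∃' (substF (suc k) (liftT 0 u) A)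

-- (t/x)A where A is the body of a quantifier binding x (= index 0)
_[_] : Form → Term → Form
A [ t ] = substF 0 t A

-- Contexts are lists read up to permutation (multisets):
-- the rule `perm` identifies sequents whose contexts are the same multiset.
-- Eigenvariable conditions ("x not free in Γ, ...") are rendered in the
-- de Bruijn way by weakening the side formulas with ↑.
infix 2 _⊢_
data _⊢_ : List Form → Form → Set where
  perm     : ∀ {Γ Δ G} → Γ ↭ Δ → Γ ⊢ G → Δ ⊢ G
  axiom    : ∀ {Γ p ts} → atom p ts ∷ Γ ⊢ atom p ts
  ⊤-right  : ∀ {Γ} → Γ ⊢ ⊤'
  ⊥-left   : ∀ {Γ G} → ⊥' ∷ Γ ⊢ G
  ∧-left   : ∀ {Γ A B G} → A ∷ B ∷ Γ ⊢ G → A ∧' B ∷ Γ ⊢ G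
  ∧-right  : ∀ {Γ A B} → Γ ⊢ A → Γ ⊢ B → Γ ⊢ A ∧' B
  ∨-left   : ∀ {Γ A B G} → A ∷ Γ ⊢ G → B ∷ Γ ⊢ G → A ∨' B ∷ Γ ⊢ G
  ∨-right₁ : ∀ {Γ A B} → Γ ⊢ A → Γ ⊢ A ∨' B
  ∨-right₂ : ∀ {Γ A B} → Γ ⊢ B → Γ ⊢ A ∨' B
  ⇒-left-axiom : ∀ {Γ p ts B G} →
    atom p ts ∷ B ∷ Γ ⊢ G → atom p ts ∷ (atom p ts ⇒ B) ∷ Γ ⊢ G
  ⇒-left-⊤ : ∀ {Γ B G} → B ∷ Γ ⊢ G → (⊤' ⇒ B) ∷ Γ ⊢ G
  ⇒-left-∧ : ∀ {Γ C D B G} →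
    (C ⇒ B) ∷ Γ ⊢ C → (D ⇒ B) ∷ Γ ⊢ D → B ∷ Γ ⊢ G →
    ((C ∧' D) ⇒ B) ∷ Γ ⊢ G
  ⇒-left-∨₁ : ∀ {Γ C D B G} →
    (C ⇒ B) ∷ (D ⇒ B) ∷ Γ ⊢ C → B ∷ Γ ⊢ G → ((C ∨' D) ⇒ B) ∷ Γ ⊢ G
  ⇒-left-∨₂ : ∀ {Γ C D B G} →
    (C ⇒ B) ∷ (D ⇒ B) ∷ Γ ⊢ D → B ∷ Γ ⊢ G → ((C ∨' D) ⇒ B) ∷ Γ ⊢ G
  ⇒-left-⇒ : ∀ {Γ C D B G} →
    (D ⇒ B) ∷ C ∷ Γ ⊢ D → B ∷ Γ ⊢ G → ((C ⇒ D) ⇒ B) ∷ Γ ⊢ G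
  ⇒-left-∀ : ∀ {Γ C B G} →
    ↑ (∀' C ⇒ B) ∷ ↑ctx Γ ⊢ C → B ∷ Γ ⊢ G → (∀' C ⇒ B) ∷ Γ ⊢ G
  ⇒-left-∃ : ∀ {Γ C B G} (t : Term) →
    (∃' C ⇒ B) ∷ Γ ⊢ C [ t ] → B ∷ Γ ⊢ G → (∃' C ⇒ B) ∷ Γ ⊢ G
  ⇒-right  : ∀ {Γ A B} → A ∷ Γ ⊢ B → Γ ⊢ A ⇒ B
  ∀-right  : ∀ {Γ A} → ↑ctx Γ ⊢ A → Γ ⊢ ∀' A
  contr-∀-left : ∀ {Γ A G} (t : Term) →
    ∀' A ∷ A [ t ] ∷ Γ ⊢ G → ∀' A ∷ Γ ⊢ G
  ∃-left   : ∀ {Γ A G} → A ∷ ↑ctx Γ ⊢ ↑ G → ∃' A ∷ Γ ⊢ G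
  ∃-right  : ∀ {Γ A} (t : Term) → Γ ⊢ A [ t ] → Γ ⊢ ∃' A

module Submission where

-- The statement is generalised from "C ⇒ D at the head of the context" to
-- "C ⇒ D anywhere in the context", captured by the relation
-- `Replaced C D Γ Γ'` (Γ' is Γ with one occurrence of C ⇒ D replaced by D).
-- The theorem then follows by induction on the derivation of Γ ⊢ G:
--   * rules not acting on the marked occurrence are re-applied, the
--     replacement being pushed into their premises (through the extra
--     hypotheses they add, and through the shift ↑ for eigenvariable rules);
--   * every left rule whose principal formula is the marked C ⇒ D has a
--     premise B ∷ Γ ⊢ G with B = D, which is exactly the required sequent;
--   * the structural rule `perm` is handled by transporting the replacement
--     along the permutation.

open import Defs
open import Data.List using (List; _∷_)
open import Data.Product using (∃-syntax; _×_; _,_)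
open import Data.List.Relation.Binary.Permutation.Propositional
  using (_↭_; refl; prep; swap; trans)

data Replaced (C D : Form) : List Form → List Form → Set where
  here  : ∀ {Γ} → Replaced C D ((C ⇒ D) ∷ Γ) (D ∷ Γ)
  there : ∀ {A Γ Γ'} → Replaced C D Γ Γ' → Replaced C D (A ∷ Γ) (A ∷ Γ')

-- Shifting free variables commutes with the replacement, since ↑ distributes
-- over ⇒; needed for the rules with an eigenvariable condition.
↑-replaced : ∀ {C D Γ Γ'} →
  Replaced C D Γ Γ' → Replaced (↑ C) (↑ D) (↑ctx Γ) (↑ctx Γ')
↑-replaced here      = here
↑-replaced (there r) = there (↑-replaced r)

replaced-↭ : ∀ {C D Γ Δ Δ'} → Γ ↭ Δ → Replaced C D Δ Δ' →
  ∃[ Γ' ] Replaced C D Γ Γ' × Γ' ↭ Δ'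
replaced-↭ {Δ' = Δ'} refl r = Δ' , r , refl
replaced-↭ {D = D} (prep _ p) here = _ , here , prep D p
replaced-↭ (prep x p) (there r) with replaced-↭ p r
... | Γ' , r' , q = x ∷ Γ' , there r' , prep x q
replaced-↭ {D = D} (swap x _ p) here = _ , there here , swap x D p
replaced-↭ {D = D} (swap _ y p) (there here) = _ , here , swap D y p
replaced-↭ (swap x y p) (there (there r)) with replaced-↭ p r
... | Γ' , r' , q = x ∷ y ∷ Γ' , there (there r') , swap x y q
replaced-↭ (trans p q) r with replaced-↭ q r
... | M' , r₁ , q₁ with replaced-↭ p r₁
... | Γ' , r₂ , q₂ = Γ' , r₂ , trans q₂ q₁

-- In each left-⇒ rule on the marked occurrence the premise
-- B ∷ Γ ⊢ G (with B = D) is already the conclusion sought.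
replace-⊢ : ∀ {C D Γ Γ' G} → Γ ⊢ G → Replaced C D Γ Γ' → Γ' ⊢ G
replace-⊢ (perm p d) r with replaced-↭ p r
... | _ , r' , q = perm q (replace-⊢ d r')
replace-⊢ axiom (there r) = axiom
replace-⊢ ⊤-right r = ⊤-right
replace-⊢ ⊥-left (there r) = ⊥-left
replace-⊢ (∧-left d) (there r) = ∧-left (replace-⊢ d (there (there r)))
replace-⊢ (∧-right d e) r = ∧-right (replace-⊢ d r) (replace-⊢ e r)
replace-⊢ (∨-left d e) (there r) =
  ∨-left (replace-⊢ d (there r)) (replace-⊢ e (there r))
replace-⊢ (∨-right₁ d) r = ∨-right₁ (replace-⊢ d r)
replace-⊢ (∨-right₂ d) r = ∨-right₂ (replace-⊢ d r)
replace-⊢ (⇒-left-axiom d) (there here) = d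
replace-⊢ (⇒-left-axiom d) (there (there r)) =
  ⇒-left-axiom (replace-⊢ d (there (there r)))
replace-⊢ (⇒-left-⊤ d) here = d
replace-⊢ (⇒-left-⊤ d) (there r) = ⇒-left-⊤ (replace-⊢ d (there r))
replace-⊢ (⇒-left-∧ _ _ f) here = f
replace-⊢ (⇒-left-∧ d e f) (there r) =
  ⇒-left-∧ (replace-⊢ d (there r)) (replace-⊢ e (there r)) (replace-⊢ f (there r))
replace-⊢ (⇒-left-∨₁ _ f) here = f
replace-⊢ (⇒-left-∨₁ d f) (there r) =
  ⇒-left-∨₁ (replace-⊢ d (there (there r))) (replace-⊢ f (there r))
replace-⊢ (⇒-left-∨₂ _ f) here = f
replace-⊢ (⇒-left-∨₂ d f) (there r) =
  ⇒-left-∨₂ (replace-⊢ d (there (there r))) (replace-⊢ f (there r))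
replace-⊢ (⇒-left-⇒ _ f) here = f
replace-⊢ (⇒-left-⇒ d f) (there r) =
  ⇒-left-⇒ (replace-⊢ d (there (there r))) (replace-⊢ f (there r))
replace-⊢ (⇒-left-∀ _ f) here = f
replace-⊢ (⇒-left-∀ d f) (there r) =
  ⇒-left-∀ (replace-⊢ d (there (↑-replaced r))) (replace-⊢ f (there r))
replace-⊢ (⇒-left-∃ _ _ f) here = f
replace-⊢ (⇒-left-∃ t d f) (there r) =
  ⇒-left-∃ t (replace-⊢ d (there r)) (replace-⊢ f (there r))
replace-⊢ (⇒-right d) r = ⇒-right (replace-⊢ d (there r))
replace-⊢ (∀-right d) r = ∀-right (replace-⊢ d (↑-replaced r))
replace-⊢ (contr-∀-left t d) (there r) =
  contr-∀-left t (replace-⊢ d (there (there r)))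
replace-⊢ (∃-left d) (there r) = ∃-left (replace-⊢ d (there (↑-replaced r)))
replace-⊢ (∃-right t d) r = ∃-right t (replace-⊢ d r)

lemma7 : (Γ : List Form) (C D G : Form) → (C ⇒ D) ∷ Γ ⊢ G → D ∷ Γ ⊢ G
lemma7 Γ C D G d = replace-⊢ d here
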